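{- For all integers $n,m,k\geq 0$, $$A_{n+m,m}=\sum_{j=0}^{n}(-1)^{n-j}\binom{n}{j}B_{m+j},\qquad A_{n+m+k,m+k}=\sum_{j=0}^{m}\binom{m}{j}A_{n+k+j,k}.$$
   Context: A partition of a finite set is a collection of nonempty, pairwise disjoint subsets (blocks) whose union is the set; a singleton of a partition is a block with exactly one element. $B_n$ denotes the $n$-th Bell number, the number of partitions of $\{1,\dots,n\}$ ($B_0=1$). For integers $0\leq k\leq n$, $A_{n,k}$ denotes the number of partitions of $\{1,2,\dots,n+1\}$ whose largest singleton is $k+1$ (i.e. $\{k+1\}$ is a block and no $j>k+1$ forms a singleton block). -}

module Defs where

open import Data.Bool using (Bool; true; false; _∧_; _∨_; not)
open import Data.Nat using (ℕ; zero; suc; _+_; _≡ᵇ_; _≤ᵇ_)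
open import Data.Nat.Combinatorics using (_C_)
open import Data.Maybe using (Maybe; just; nothing)
open import Data.List using (List; []; _∷_; [_]; _++_; map; filter; length; foldr; upTo)
open import Data.Bool.ListAction using (all; any)
open import Relation.Nullary.Decidable using (T?)
open import Data.Vec using (Vec; []; _∷_)
open import Data.Fin.Subset using (Subset; inside; outside; _∩_; _∪_; ⊥; ⊤)
open import Data.Integer as ℤ using (ℤ)
open import Relation.Nullary.Decidable using (does)
open import Data.Fin.Subset.Properties using ()
open import Function using (_∘_)

subsets : (n : ℕ) → List (Subset n)
subsets zero = [ [] ]
subsets (suc n) = map (outside ∷_) (subsets n) ++ map (inside ∷_) (subsets n)

sublists : ∀ {a} {A : Set a} → List A → List (List A)
sublists [] = [ [] ]
sublists (x ∷ xs) = sublists xs ++ map (x ∷_) (sublists xs)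

isEmpty : ∀ {n} → Subset n → Bool
isEmpty [] = true
isEmpty (x ∷ xs) = not x ∧ isEmpty xs

isFull : ∀ {n} → Subset n → Bool
isFull [] = true
isFull (x ∷ xs) = x ∧ isFull xs

disjoint : ∀ {n} → Subset n → Subset n → Bool
disjoint b c = isEmpty (b ∩ c)

pairwiseDisjoint : ∀ {n} → List (Subset n) → Bool
pairwiseDisjoint [] = true
pairwiseDisjoint (b ∷ bs) = all (disjoint b) bs ∧ pairwiseDisjoint bs

union : ∀ {n} → List (Subset n) → Subset n
union = foldr _∪_ ⊥

isPartition : ∀ {n} → List (Subset n) → Bool
isPartition bs = all (not ∘ isEmpty) bs ∧ pairwiseDisjoint bs ∧ isFull (union bs)

-- All partitions of Fin n (a collection of blocks = a sub-collection of
-- the list of all subsets, so each set of blocks is listed once).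
partitions : (n : ℕ) → List (List (Subset n))
partitions n = filter (λ bs → T? (isPartition bs)) (sublists (subsets n))

Bell : ℕ → ℕ
Bell n = length (partitions n)

singletonAt : ∀ {n} → Subset n → Maybe ℕ
singletonAt [] = nothing
singletonAt (inside ∷ xs) with isEmpty xs
... | true = just 0
... | false = nothing
singletonAt (outside ∷ xs) with singletonAt xs
... | just i = just (suc i)
... | nothing = nothing

isSingletonAt : ℕ → ∀ {n} → Subset n → Bool
isSingletonAt k b with singletonAt b
... | just i = i ≡ᵇ k
... | nothing = false

singletonAtMost : ℕ → ∀ {n} → Subset n → Bool
singletonAtMost k b with singletonAt b
... | just i = i ≤ᵇ k
... | nothing = true

-- Partitions of {1,…,n+1} (here Fin (n+1), element j+1 ↔ index j)
-- whose largest singleton is k+1: the block {k+1} occurs and no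
-- singleton block {j+1} with j > k occurs.
largestSingletonIs : ℕ → ∀ {N} → List (Subset N) → Bool
largestSingletonIs k bs = any (isSingletonAt k) bs ∧ all (singletonAtMost k) bs

A : ℕ → ℕ → ℕ
A n k = length (filter (λ bs → T? (largestSingletonIs k bs)) (partitions (suc n)))

sumTo : ℕ → (ℕ → ℕ) → ℕ
sumTo n f = foldr (λ j acc → f j + acc) 0 (upTo (suc n))

sumToℤ : ℕ → (ℕ → ℤ) → ℤ
sumToℤ n f = foldr (λ j acc → f j ℤ.+ acc) (ℤ.+ 0) (upTo (suc n))

module Submission where

-- Write a m n for A (n + m) m.  It satisfies the Pascal recurrence a (m + 1) n = a m n + a m (n + 1)
-- and a m 0 = Bell m, and both identities follow from these alone: iterating the recurrence expands
-- a (m + k) n binomially in the a k (n + j), and solving it for a m (n + 1) inverts that expansion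
-- with alternating signs.
--
-- For the recurrence, let every element carry a tag: free, single (its block must be a singleton)
-- or nonSingle (its block must not be).  A N k counts the partitions of N + 1 elements in which
-- the elements below k + 1 are free, k + 1 is single and the larger ones are nonSingle.
-- Transposing two coordinates permutes partitions, so the count depends only on the multiset of
-- tags; a free element is either single or nonSingle, and a single element can be deleted.
-- Applied to the free element k + 1 of A N (k + 1), the first case deletes k + 2 and leaves
-- A (N - 1) k, the second swaps the tags of k + 1 and k + 2 and leaves A N k.

open import Defs
open import Algebra.Bundles using (CommutativeMonoid)
import Algebra.Properties.CommutativeSemigroup as CommutativeSemigroupProperties
open import Data.Bool using (Bool; true; false; _∧_; _∨_; not; if_then_else_)
open import Data.Bool.ListAction using (all; any; and; or)
open import Data.Bool.Properties as Bool
  using (∧-comm; ∧-zeroʳ; ∧-identityʳ; ∧-conicalˡ; ∧-conicalʳ; ∨-zeroʳ; ∨-identityʳ; not-involutive)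
open import Data.Fin using (Fin; zero; suc; toℕ; fromℕ; inject₁)
open import Data.Fin.Properties using (toℕ<n; toℕ-fromℕ; toℕ-inject₁; toℕ≤pred[n])
open import Data.Fin.Subset using (Subset; inside; outside; _∩_; _∪_; ⊥; ⁅_⁆)
open import Data.Fin.Subset.Properties using (∩-comm; ∪-comm; ∪-assoc; ∪-identityˡ)
open import Data.Integer as ℤ using (ℤ; +_; -_; -1ℤ; _^_)
import Data.Integer.Properties as ℤ
open import Data.List using (List; []; _∷_; [_]; _++_; map; filter; length; foldr; applyUpTo)
open import Data.List.Properties using (map-++; map-∘; map-cong; ++-assoc; ++-identityʳ)
open import Data.List.Relation.Binary.Permutation.Propositional as ↭ using (_↭_)
import Data.List.Relation.Binary.Permutation.Propositional.Properties as ↭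
open import Data.Maybe using (just; nothing)
open import Data.Nat as ℕ using (ℕ; zero; suc; _∸_; _<_; _≤_; s≤s)
import Data.Nat.Properties as ℕ
open import Data.Nat.Combinatorics using (_C_; nCk+nC[k+1]≡[n+1]C[k+1]; k>n⇒nCk≡0)
open import Data.Product using (_×_; _,_; ∃-syntax; proj₁; proj₂)
open import Data.Vec as Vec using (Vec; []; _∷_; zipWith; replicate)
open import Data.Vec.Properties using (map-replicate)
open import Function using (id; _∘_; _∘′_)
open import Level using (0ℓ)
open import Relation.Binary.Core using (Rel; _Preserves_⟶_)
open import Relation.Binary.Construct.Closure.ReflexiveTransitive using (Star; ε; _◅_; _◅◅_)
open import Relation.Binary.PropositionalEquality hiding ([_])
open import Relation.Nullary.Decidable using (T?)

private
  module ℕ-+ = CommutativeSemigroupProperties ℕ.+-commutativeSemigroup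
  module ℤ-+ = CommutativeSemigroupProperties ℤ.+-commutativeSemigroup
  module ℤ-* = CommutativeSemigroupProperties ℤ.*-commutativeSemigroup
  module Bool-∧ = CommutativeSemigroupProperties (CommutativeMonoid.commutativeSemigroup Bool.∧-commutativeMonoid)

-- Binomial sums and Pascal arrays

module BinomialTransform where

  open import Data.Integer using (_+_; _*_)
  open import Data.Integer.Tactic.RingSolver using (solve-∀)
  open import Algebra.Properties.Semiring.Sum ℤ.+-*-semiring
    using (sum; sum⁺-syntax; sum-cong-≗; ∑-distrib-+; sum-init-last; *-distribˡ-sum)
  open ≡-Reasoning

  binomialSum : ℕ → (ℕ → ℤ) → ℤ
  binomialSum m f = ∑[ j ≤ m ] (+ (m C toℕ j) * f (toℕ j))

  binomialSum-cong : ∀ m {f g : ℕ → ℤ} → (∀ j → j ≤ m → f j ≡ g j) →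
                     binomialSum m f ≡ binomialSum m g
  binomialSum-cong m f≗g = sum-cong-≗ λ j → cong (+ (m C toℕ j) *_) (f≗g (toℕ j) (toℕ≤pred[n] j))

  binomialSum-suc : ∀ m f → binomialSum (suc m) f ≡ binomialSum m f + binomialSum m (λ j → f (suc j))
  binomialSum-suc m f = begin
    + 1 * f 0 + sum {suc m} (λ j → + (suc m C suc (toℕ j)) * f (suc (toℕ j)))
      ≡⟨ cong (λ s → + 1 * f 0 + s) (sum-cong-≗ {suc m} (λ j → pascal (toℕ j))) ⟩
    + 1 * f 0 + sum {suc m} (λ j → lower (toℕ j) + upper (toℕ j))
      ≡⟨ cong (λ s → + 1 * f 0 + s) (∑-distrib-+ {suc m} (lower ∘′ toℕ) (upper ∘′ toℕ)) ⟩
    + 1 * f 0 + (binomialSum m (λ j → f (suc j)) + sum {suc m} (upper ∘′ toℕ))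
      ≡⟨ cong (λ s → + 1 * f 0 + (binomialSum m (λ j → f (suc j)) + s)) drop-last ⟩
    + 1 * f 0 + (binomialSum m (λ j → f (suc j)) + sum {m} (upper ∘′ toℕ))
      ≡⟨ ℤ-+.x∙yz≈xz∙y (+ 1 * f 0) _ _ ⟩
    binomialSum m f + binomialSum m (λ j → f (suc j)) ∎
    where
    lower upper : ℕ → ℤ
    lower j = + (m C j) * f (suc j)
    upper j = + (m C suc j) * f (suc j)
    pascal : ∀ j → + (suc m C suc j) * f (suc j) ≡ lower j + upper j
    pascal j = begin
      + (suc m C suc j) * f (suc j)
        ≡⟨ cong (λ c → + c * f (suc j)) (nCk+nC[k+1]≡[n+1]C[k+1] m j) ⟨
      + (m C j ℕ.+ m C suc j) * f (suc j)
        ≡⟨ cong (_* f (suc j)) (ℤ.pos-+ (m C j) (m C suc j)) ⟩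
      (+ (m C j) + + (m C suc j)) * f (suc j)
        ≡⟨ ℤ.*-distribʳ-+ (f (suc j)) (+ (m C j)) (+ (m C suc j)) ⟩
      lower j + upper j ∎
    upper-last : upper m ≡ + 0
    upper-last = trans (cong (λ c → + c * f (suc m)) (k>n⇒nCk≡0 {m} {suc m} (ℕ.n<1+n m)))
                       (ℤ.*-zeroˡ (f (suc m)))
    drop-last : sum {suc m} (upper ∘′ toℕ) ≡ sum {m} (upper ∘′ toℕ)
    drop-last = begin
      sum {suc m} (upper ∘′ toℕ)
        ≡⟨ sum-init-last {m} (upper ∘′ toℕ) ⟩
      sum {m} (upper ∘′ toℕ ∘′ inject₁) + upper (toℕ (fromℕ m))
        ≡⟨ cong₂ _+_ (sum-cong-≗ {m} (λ j → cong upper (toℕ-inject₁ j)))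
                     (trans (cong upper (toℕ-fromℕ m)) upper-last) ⟩
      sum {m} (upper ∘′ toℕ) + + 0
        ≡⟨ ℤ.+-identityʳ (sum {m} (upper ∘′ toℕ)) ⟩
      sum {m} (upper ∘′ toℕ) ∎

  binomialSum-neg : ∀ m f → binomialSum m (λ j → - f j) ≡ - binomialSum m f
  binomialSum-neg m f = begin
    binomialSum m (λ j → - f j)
      ≡⟨ sum-cong-≗ {suc m} (λ j → sign-inside (+ (m C toℕ j)) (f (toℕ j))) ⟩
    sum {suc m} (λ j → -1ℤ * (+ (m C toℕ j) * f (toℕ j)))
      ≡⟨ *-distribˡ-sum {suc m} -1ℤ (λ j → + (m C toℕ j) * f (toℕ j)) ⟨
    -1ℤ * binomialSum m f
      ≡⟨ ℤ.-1*i≡-i (binomialSum m f) ⟩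
    - binomialSum m f ∎
    where
    sign-inside : ∀ c x → c * - x ≡ -1ℤ * (c * x)
    sign-inside = solve-∀

  sumToℤ≡binomialSum : ∀ n {h f : ℕ → ℤ} → (∀ j → h j ≡ + (n C j) * f j) →
                       sumToℤ n h ≡ binomialSum n f
  sumToℤ≡binomialSum n {h} h≗ =
    trans (foldr-applyUpTo id (suc n)) (sum-cong-≗ {suc n} (λ j → h≗ (toℕ j)))
    where
    foldr-applyUpTo : ∀ g k → foldr (λ j acc → h j + acc) (+ 0) (applyUpTo g k) ≡
                              sum {k} (λ j → h (g (toℕ j)))
    foldr-applyUpTo g zero    = refl
    foldr-applyUpTo g (suc k) = cong (λ s → h (g 0) + s) (foldr-applyUpTo (g ∘′ suc) k)

  IsPascalArray : (ℕ → ℕ → ℤ) → Set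
  IsPascalArray g = ∀ a b → g (suc a) b ≡ g a b + g a (suc b)

  module _ {g : ℕ → ℕ → ℤ} (pascal : IsPascalArray g) where

    pascalArray-binomial : ∀ m k n → g (m ℕ.+ k) n ≡ binomialSum m (λ j → g k (n ℕ.+ j))
    pascalArray-binomial zero k n = begin
      g k n                       ≡⟨ cong (g k) (ℕ.+-identityʳ n) ⟨
      g k (n ℕ.+ 0)               ≡⟨ single-term (g k (n ℕ.+ 0)) ⟩
      + 1 * g k (n ℕ.+ 0) + + 0   ∎
      where
      single-term : ∀ x → x ≡ + 1 * x + + 0
      single-term = solve-∀
    pascalArray-binomial (suc m) k n = begin
      g (suc m ℕ.+ k) n
        ≡⟨ pascal (m ℕ.+ k) n ⟩
      g (m ℕ.+ k) n + g (m ℕ.+ k) (suc n)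
        ≡⟨ cong₂ _+_ (pascalArray-binomial m k n) (pascalArray-binomial m k (suc n)) ⟩
      binomialSum m (λ j → g k (n ℕ.+ j)) + binomialSum m (λ j → g k (suc n ℕ.+ j))
        ≡⟨ cong (λ s → binomialSum m (λ j → g k (n ℕ.+ j)) + s)
                (binomialSum-cong m (λ j _ → cong (g k) (ℕ.+-suc n j))) ⟨
      binomialSum m (λ j → g k (n ℕ.+ j)) + binomialSum m (λ j → g k (n ℕ.+ suc j))
        ≡⟨ binomialSum-suc m (λ j → g k (n ℕ.+ j)) ⟨
      binomialSum (suc m) (λ j → g k (n ℕ.+ j)) ∎

    pascalArray-alternating : ∀ n m → g m n ≡ binomialSum n (λ j → (-1ℤ ^ (n ∸ j)) * g (m ℕ.+ j) 0)
    pascalArray-alternating zero m = begin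
      g m 0                                ≡⟨ cong (λ a → g a 0) (ℕ.+-identityʳ m) ⟨
      g (m ℕ.+ 0) 0                        ≡⟨ single-term (g (m ℕ.+ 0) 0) ⟩
      + 1 * (+ 1 * g (m ℕ.+ 0) 0) + + 0    ∎
      where
      single-term : ∀ x → x ≡ + 1 * (+ 1 * x) + + 0
      single-term = solve-∀
    pascalArray-alternating (suc n) m = begin
      g m (suc n)
        ≡⟨ solve-for-last (g m n) (g m (suc n)) ⟩
      - g m n + (g m n + g m (suc n))
        ≡⟨ cong (λ y → - g m n + y) (pascal m n) ⟨
      - g m n + g (suc m) n
        ≡⟨ cong₂ (λ x y → - x + y) (pascalArray-alternating n m) (pascalArray-alternating n (suc m)) ⟩
      - binomialSum n (alt n m) + binomialSum n (alt n (suc m))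
        ≡⟨ cong₂ _+_ (binomialSum-neg n (alt n m)) (binomialSum-cong n shift) ⟨
      binomialSum n (λ j → - alt n m j) + binomialSum n (λ j → alt (suc n) m (suc j))
        ≡⟨ cong (λ s → s + binomialSum n (λ j → alt (suc n) m (suc j))) (binomialSum-cong n flip-sign) ⟩
      binomialSum n (alt (suc n) m) + binomialSum n (λ j → alt (suc n) m (suc j))
        ≡⟨ binomialSum-suc n (alt (suc n) m) ⟨
      binomialSum (suc n) (alt (suc n) m) ∎
      where
      alt : ℕ → ℕ → ℕ → ℤ
      alt k a j = (-1ℤ ^ (k ∸ j)) * g (a ℕ.+ j) 0
      solve-for-last : ∀ x y → y ≡ - x + (x + y)
      solve-for-last = solve-∀
      negate-sign : ∀ s x → - (s * x) ≡ (-1ℤ * s) * x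
      negate-sign = solve-∀
      shift : ∀ j → j ≤ n → alt (suc n) m (suc j) ≡ alt n (suc m) j
      shift j _ = cong (λ a → (-1ℤ ^ (n ∸ j)) * g a 0) (ℕ.+-suc m j)
      flip-sign : ∀ j → j ≤ n → - alt n m j ≡ alt (suc n) m j
      flip-sign j j≤n = begin
        - alt n m j
          ≡⟨ negate-sign (-1ℤ ^ (n ∸ j)) (g (m ℕ.+ j) 0) ⟩
        (-1ℤ ^ suc (n ∸ j)) * g (m ℕ.+ j) 0
          ≡⟨ cong (λ e → (-1ℤ ^ e) * g (m ℕ.+ j) 0) (ℕ.+-∸-assoc 1 j≤n) ⟨
        alt (suc n) m j ∎

open BinomialTransform

open import Data.Nat using (_+_; _*_)
open import Data.Nat.ListAction using (sum)
open import Data.Nat.ListAction.Properties using (sum-++)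

fromBool : Bool → ℕ
fromBool true = 1
fromBool false = 0

sumBy : {X : Set} → (X → ℕ) → List X → ℕ
sumBy f xs = sum (map f xs)

module _ {X : Set} where

  sumBy-++ : ∀ (f : X → ℕ) xs ys → sumBy f (xs ++ ys) ≡ sumBy f xs + sumBy f ys
  sumBy-++ f xs ys = trans (cong sum (map-++ f xs ys)) (sum-++ (map f xs) (map f ys))

  sumBy-map : ∀ {Y : Set} (f : Y → ℕ) (g : X → Y) xs → sumBy f (map g xs) ≡ sumBy (f ∘ g) xs
  sumBy-map f g xs = cong sum (sym (map-∘ xs))

  sumBy-cong : ∀ {f g : X → ℕ} → (∀ x → f x ≡ g x) → ∀ xs → sumBy f xs ≡ sumBy g xs
  sumBy-cong f≗g xs = cong sum (map-cong f≗g xs)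

  sumBy-+ : ∀ (f g : X → ℕ) xs → sumBy (λ x → f x + g x) xs ≡ sumBy f xs + sumBy g xs
  sumBy-+ f g [] = refl
  sumBy-+ f g (x ∷ xs) = trans (cong (λ s → f x + g x + s) (sumBy-+ f g xs)) (ℕ-+.interchange (f x) (g x) _ _)

  sumBy-zero : ∀ {f : X → ℕ} → (∀ x → f x ≡ 0) → ∀ xs → sumBy f xs ≡ 0
  sumBy-zero f≗0 [] = refl
  sumBy-zero f≗0 (x ∷ xs) = cong₂ _+_ (f≗0 x) (sumBy-zero f≗0 xs)

  length-filter : ∀ (p : X → Bool) xs → length (filter (T? ∘ p) xs) ≡ sumBy (fromBool ∘ p) xs
  length-filter p [] = refl
  length-filter p (x ∷ xs) with p x
  ... | true  = cong suc (length-filter p xs)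
  ... | false = length-filter p xs

  length-filter-filter : ∀ (p q : X → Bool) xs →
    length (filter (T? ∘ q) (filter (T? ∘ p) xs)) ≡ sumBy (λ x → fromBool (p x ∧ q x)) xs
  length-filter-filter p q [] = refl
  length-filter-filter p q (x ∷ xs) with p x
  ... | false = length-filter-filter p q xs
  ... | true with q x
  ...   | true  = cong suc (length-filter-filter p q xs)
  ...   | false = length-filter-filter p q xs

module _ {X : Set} where

  sumBy-sublists-∷ : ∀ (f : List X → ℕ) x xs →
    sumBy f (sublists (x ∷ xs)) ≡ sumBy f (sublists xs) + sumBy (f ∘ (x ∷_)) (sublists xs)
  sumBy-sublists-∷ f x xs =
    trans (sumBy-++ f (sublists xs) _) (cong (λ s → sumBy f (sublists xs) + s) (sumBy-map f (x ∷_) (sublists xs)))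

  sumBy-sublists-∷∷ : ∀ (f : List X → ℕ) x y xs →
    sumBy f (sublists (x ∷ y ∷ xs)) ≡
    (sumBy f (sublists xs) + sumBy (f ∘ (y ∷_)) (sublists xs)) +
    (sumBy (f ∘ (x ∷_)) (sublists xs) + sumBy (f ∘ (x ∷_) ∘ (y ∷_)) (sublists xs))
  sumBy-sublists-∷∷ f x y xs =
    trans (sumBy-sublists-∷ f x (y ∷ xs))
          (cong₂ _+_ (sumBy-sublists-∷ f y xs) (sumBy-sublists-∷ (f ∘ (x ∷_)) y xs))

  sumBy-sublists-++ : ∀ (f : List X → ℕ) xs ys →
    sumBy f (sublists (xs ++ ys)) ≡ sumBy (λ as → sumBy (f ∘ (as ++_)) (sublists ys)) (sublists xs)
  sumBy-sublists-++ f [] ys = sym (ℕ.+-identityʳ _)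
  sumBy-sublists-++ f (x ∷ xs) ys = begin
    sumBy f (sublists (x ∷ xs ++ ys))
      ≡⟨ sumBy-sublists-∷ f x (xs ++ ys) ⟩
    sumBy f (sublists (xs ++ ys)) + sumBy (f ∘ (x ∷_)) (sublists (xs ++ ys))
      ≡⟨ cong₂ _+_ (sumBy-sublists-++ f xs ys) (sumBy-sublists-++ (f ∘ (x ∷_)) xs ys) ⟩
    sumBy (λ as → sumBy (f ∘ (as ++_)) (sublists ys)) (sublists xs) +
    sumBy (λ as → sumBy (f ∘ ((x ∷ as) ++_)) (sublists ys)) (sublists xs)
      ≡⟨ sumBy-sublists-∷ (λ as → sumBy (f ∘ (as ++_)) (sublists ys)) x xs ⟨
    sumBy (λ as → sumBy (f ∘ (as ++_)) (sublists ys)) (sublists (x ∷ xs)) ∎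
    where open ≡-Reasoning

  sublists-map : ∀ {Y : Set} (g : X → Y) xs → sublists (map g xs) ≡ map (map g) (sublists xs)
  sublists-map g [] = refl
  sublists-map g (x ∷ xs) = begin
    sublists (map g xs) ++ map (g x ∷_) (sublists (map g xs))
      ≡⟨ cong (λ s → s ++ map (g x ∷_) s) (sublists-map g xs) ⟩
    map (map g) (sublists xs) ++ map (g x ∷_) (map (map g) (sublists xs))
      ≡⟨ cong (map (map g) (sublists xs) ++_) (trans (sym (map-∘ (sublists xs))) (map-∘ (sublists xs))) ⟨
    map (map g) (sublists xs) ++ map (map g) (map (x ∷_) (sublists xs))
      ≡⟨ map-++ (map g) (sublists xs) _ ⟨
    map (map g) (sublists (x ∷ xs)) ∎
    where open ≡-Reasoning

  sumBy-sublists-↭ : ∀ (f : List X → ℕ) → f Preserves _↭_ ⟶ _≡_ →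
    ∀ {xs ys} → xs ↭ ys → sumBy f (sublists xs) ≡ sumBy f (sublists ys)
  sumBy-sublists-↭ f f-inv ↭.refl = refl
  sumBy-sublists-↭ f f-inv {x ∷ xs} {x ∷ ys} (↭.prep x p) = begin
    sumBy f (sublists (x ∷ xs))
      ≡⟨ sumBy-sublists-∷ f x xs ⟩
    sumBy f (sublists xs) + sumBy (f ∘ (x ∷_)) (sublists xs)
      ≡⟨ cong₂ _+_ (sumBy-sublists-↭ f f-inv p) (sumBy-sublists-↭ (f ∘ (x ∷_)) (f-inv ∘ ↭.prep x) p) ⟩
    sumBy f (sublists ys) + sumBy (f ∘ (x ∷_)) (sublists ys)
      ≡⟨ sumBy-sublists-∷ f x ys ⟨
    sumBy f (sublists (x ∷ ys)) ∎
    where open ≡-Reasoning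
  sumBy-sublists-↭ f f-inv {x ∷ y ∷ xs} {y ∷ x ∷ ys} (↭.swap x y p) = begin
    sumBy f (sublists (x ∷ y ∷ xs))
      ≡⟨ sumBy-sublists-∷∷ f x y xs ⟩
    (S xs f + S xs (f ∘ (y ∷_))) + (S xs (f ∘ (x ∷_)) + S xs (f ∘ (x ∷_) ∘ (y ∷_)))
      ≡⟨ cong₂ _+_ (cong₂ _+_ (sumBy-sublists-↭ f f-inv p)
                              (sumBy-sublists-↭ (f ∘ (y ∷_)) (f-inv ∘ ↭.prep y) p))
                   (cong₂ _+_ (sumBy-sublists-↭ (f ∘ (x ∷_)) (f-inv ∘ ↭.prep x) p)
                              swapped-heads) ⟩
    (S ys f + S ys (f ∘ (y ∷_))) + (S ys (f ∘ (x ∷_)) + S ys (f ∘ (y ∷_) ∘ (x ∷_)))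
      ≡⟨ ℕ-+.interchange (S ys f) _ _ _ ⟩
    (S ys f + S ys (f ∘ (x ∷_))) + (S ys (f ∘ (y ∷_)) + S ys (f ∘ (y ∷_) ∘ (x ∷_)))
      ≡⟨ sumBy-sublists-∷∷ f y x ys ⟨
    sumBy f (sublists (y ∷ x ∷ ys)) ∎
    where
    open ≡-Reasoning
    S : List X → (List X → ℕ) → ℕ
    S zs g = sumBy g (sublists zs)
    swapped-heads : S xs (f ∘ (x ∷_) ∘ (y ∷_)) ≡ S ys (f ∘ (y ∷_) ∘ (x ∷_))
    swapped-heads = trans (sumBy-sublists-↭ (f ∘ (x ∷_) ∘ (y ∷_)) (f-inv ∘ ↭.prep x ∘ ↭.prep y) p)
                          (sumBy-cong (λ _ → f-inv (↭.swap x y ↭.refl)) (sublists ys))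
  sumBy-sublists-↭ f f-inv (↭.trans p q) = trans (sumBy-sublists-↭ f f-inv p) (sumBy-sublists-↭ f f-inv q)

  sumBy-sublists-nil-only : ∀ (f : List X → ℕ) → (∀ c cs → f (c ∷ cs) ≡ 0) →
    ∀ xs → sumBy f (sublists xs) ≡ f []
  sumBy-sublists-nil-only f f≡0 [] = ℕ.+-identityʳ (f [])
  sumBy-sublists-nil-only f f≡0 (x ∷ xs) =
    trans (sumBy-sublists-∷ f x xs)
          (trans (cong₂ _+_ (sumBy-sublists-nil-only f f≡0 xs) (sumBy-zero (f≡0 x) (sublists xs)))
                 (ℕ.+-identityʳ (f [])))

  sumBy-sublists-singletons-only : ∀ (f : List X → ℕ) → f [] ≡ 0 → (∀ c d ds → f (c ∷ d ∷ ds) ≡ 0) →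
    ∀ xs → sumBy f (sublists xs) ≡ sumBy (f ∘ [_]) xs
  sumBy-sublists-singletons-only f f[]≡0 f≡0 [] = trans (ℕ.+-identityʳ (f [])) f[]≡0
  sumBy-sublists-singletons-only f f[]≡0 f≡0 (x ∷ xs) =
    trans (sumBy-sublists-∷ f x xs)
          (trans (cong₂ _+_ (sumBy-sublists-singletons-only f f[]≡0 f≡0 xs)
                            (sumBy-sublists-nil-only (f ∘ (x ∷_)) (f≡0 x) xs))
                 (ℕ.+-comm _ (f [ x ])))

module _ {X : Set} where

  all-map : ∀ {Y : Set} (p : Y → Bool) (g : X → Y) xs → all p (map g xs) ≡ all (p ∘ g) xs
  all-map p g xs = cong and (sym (map-∘ xs))

  all-cong : ∀ {p q : X → Bool} → (∀ x → p x ≡ q x) → ∀ xs → all p xs ≡ all q xs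
  all-cong p≗q xs = cong and (map-cong p≗q xs)

  any-cong : ∀ {p q : X → Bool} → (∀ x → p x ≡ q x) → ∀ xs → any p xs ≡ any q xs
  any-cong p≗q xs = cong or (map-cong p≗q xs)

  all-∧ : ∀ (p q : X → Bool) xs → all (λ x → p x ∧ q x) xs ≡ all p xs ∧ all q xs
  all-∧ p q [] = refl
  all-∧ p q (x ∷ xs) = trans (cong ((p x ∧ q x) ∧_) (all-∧ p q xs)) (Bool-∧.interchange (p x) (q x) _ _)

  all-true : ∀ {p : X → Bool} → (∀ x → p x ≡ true) → ∀ xs → all p xs ≡ true
  all-true p≗true xs = trans (all-cong p≗true xs) (all-const xs)
    where
    all-const : ∀ xs → all (λ _ → true) xs ≡ true
    all-const [] = refl
    all-const (x ∷ xs) = all-const xs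

  all-↭ : ∀ (p : X → Bool) {xs ys} → xs ↭ ys → all p xs ≡ all p ys
  all-↭ p ↭.refl = refl
  all-↭ p (↭.prep x q) = cong (p x ∧_) (all-↭ p q)
  all-↭ p (↭.swap x y q) =
    trans (cong (λ b → p x ∧ (p y ∧ b)) (all-↭ p q)) (Bool-∧.x∙yz≈y∙xz (p x) (p y) _)
  all-↭ p (↭.trans q r) = trans (all-↭ p q) (all-↭ p r)

-- Transposing two coordinates

swap : ∀ {X : Set} {n} → ℕ → Vec X n → Vec X n
swap zero    []          = []
swap zero    (x ∷ [])    = x ∷ []
swap zero    (x ∷ y ∷ v) = y ∷ x ∷ v
swap (suc j) []          = []
swap (suc j) (x ∷ v)     = x ∷ swap j v

module _ {X : Set} where

  swap-involutive : ∀ {n} j (v : Vec X n) → swap j (swap j v) ≡ v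
  swap-involutive zero    []          = refl
  swap-involutive zero    (x ∷ [])    = refl
  swap-involutive zero    (x ∷ y ∷ v) = refl
  swap-involutive (suc j) []          = refl
  swap-involutive (suc j) (x ∷ v)     = cong (x ∷_) (swap-involutive j v)

  swap-map : ∀ {Y : Set} {n} (f : X → Y) j (v : Vec X n) → swap j (Vec.map f v) ≡ Vec.map f (swap j v)
  swap-map f zero    []          = refl
  swap-map f zero    (x ∷ [])    = refl
  swap-map f zero    (x ∷ y ∷ v) = refl
  swap-map f (suc j) []          = refl
  swap-map f (suc j) (x ∷ v)     = cong (f x ∷_) (swap-map f j v)

  swap-zipWith : ∀ {n} (f : X → X → X) j (u v : Vec X n) →
    swap j (zipWith f u v) ≡ zipWith f (swap j u) (swap j v)
  swap-zipWith f zero    []          []          = refl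
  swap-zipWith f zero    (x ∷ [])    (x′ ∷ [])   = refl
  swap-zipWith f zero    (x ∷ y ∷ u) (x′ ∷ y′ ∷ v) = refl
  swap-zipWith f (suc j) []          []          = refl
  swap-zipWith f (suc j) (x ∷ u)     (x′ ∷ v)    = cong (f x x′ ∷_) (swap-zipWith f j u v)

  swap-replicate : ∀ n j (x : X) → swap j (replicate n x) ≡ replicate n x
  swap-replicate zero          zero    x = refl
  swap-replicate (suc zero)    zero    x = refl
  swap-replicate (suc (suc n)) zero    x = refl
  swap-replicate zero          (suc j) x = refl
  swap-replicate (suc n)       (suc j) x = cong (x ∷_) (swap-replicate n j x)

isSingleton : ∀ {n} → Subset n → Bool
isSingleton []      = false
isSingleton (x ∷ b) = if x then isEmpty b else isSingleton b

isEmpty-swap : ∀ {n} j (b : Subset n) → isEmpty (swap j b) ≡ isEmpty b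
isEmpty-swap zero    []          = refl
isEmpty-swap zero    (x ∷ [])    = refl
isEmpty-swap zero    (x ∷ y ∷ b) = Bool-∧.x∙yz≈y∙xz (not y) (not x) (isEmpty b)
isEmpty-swap (suc j) []          = refl
isEmpty-swap (suc j) (x ∷ b)     = cong (not x ∧_) (isEmpty-swap j b)

isFull-swap : ∀ {n} j (b : Subset n) → isFull (swap j b) ≡ isFull b
isFull-swap zero    []          = refl
isFull-swap zero    (x ∷ [])    = refl
isFull-swap zero    (x ∷ y ∷ b) = Bool-∧.x∙yz≈y∙xz y x (isFull b)
isFull-swap (suc j) []          = refl
isFull-swap (suc j) (x ∷ b)     = cong (x ∧_) (isFull-swap j b)

isSingleton-swap : ∀ {n} j (b : Subset n) → isSingleton (swap j b) ≡ isSingleton b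
isSingleton-swap zero    []                  = refl
isSingleton-swap zero    (x ∷ [])            = refl
isSingleton-swap zero    (true  ∷ true  ∷ b) = refl
isSingleton-swap zero    (true  ∷ false ∷ b) = refl
isSingleton-swap zero    (false ∷ true  ∷ b) = refl
isSingleton-swap zero    (false ∷ false ∷ b) = refl
isSingleton-swap (suc j) []                  = refl
isSingleton-swap (suc j) (true  ∷ b)         = isEmpty-swap j b
isSingleton-swap (suc j) (false ∷ b)         = isSingleton-swap j b

disjoint-swap : ∀ {n} j (b c : Subset n) → disjoint (swap j b) (swap j c) ≡ disjoint b c
disjoint-swap j b c = trans (cong isEmpty (sym (swap-zipWith _∧_ j b c))) (isEmpty-swap j (b ∩ c))

union-map-swap : ∀ {n} j (bs : List (Subset n)) → union (map (swap j) bs) ≡ swap j (union bs)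
union-map-swap j []       = sym (swap-replicate _ j false)
union-map-swap j (b ∷ bs) = trans (cong (swap j b ∪_) (union-map-swap j bs)) (sym (swap-zipWith _∨_ j b (union bs)))

pairwiseDisjoint-map-swap : ∀ {n} j (bs : List (Subset n)) → pairwiseDisjoint (map (swap j) bs) ≡ pairwiseDisjoint bs
pairwiseDisjoint-map-swap j []       = refl
pairwiseDisjoint-map-swap j (b ∷ bs) =
  cong₂ _∧_ (trans (all-map (disjoint (swap j b)) (swap j) bs) (all-cong (disjoint-swap j b) bs))
            (pairwiseDisjoint-map-swap j bs)

isPartition-map-swap : ∀ {n} j (bs : List (Subset n)) → isPartition (map (swap j) bs) ≡ isPartition bs
isPartition-map-swap j bs = cong₂ _∧_
  (trans (all-map (not ∘ isEmpty) (swap j) bs) (all-cong (cong not ∘ isEmpty-swap j) bs))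
  (cong₂ _∧_ (pairwiseDisjoint-map-swap j bs)
             (trans (cong isFull (union-map-swap j bs)) (isFull-swap j (union bs))))

disjoint-comm : ∀ {n} (b c : Subset n) → disjoint b c ≡ disjoint c b
disjoint-comm b c = cong isEmpty (∩-comm b c)

∪-leftComm : ∀ {n} (b c d : Subset n) → b ∪ (c ∪ d) ≡ c ∪ (b ∪ d)
∪-leftComm b c d = trans (sym (∪-assoc b c d)) (trans (cong (_∪ d) (∪-comm b c)) (∪-assoc c b d))

union-↭ : ∀ {n} {bs cs : List (Subset n)} → bs ↭ cs → union bs ≡ union cs
union-↭ ↭.refl         = refl
union-↭ (↭.prep b p)   = cong (b ∪_) (union-↭ p)
union-↭ {cs = _ ∷ _ ∷ cs} (↭.swap b c p) =
  trans (cong (λ u → b ∪ (c ∪ u)) (union-↭ p)) (∪-leftComm b c (union cs))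
union-↭ (↭.trans p q)  = trans (union-↭ p) (union-↭ q)

pairwiseDisjoint-↭ : ∀ {n} {bs cs : List (Subset n)} → bs ↭ cs → pairwiseDisjoint bs ≡ pairwiseDisjoint cs
pairwiseDisjoint-↭ ↭.refl         = refl
pairwiseDisjoint-↭ (↭.prep b p)   = cong₂ _∧_ (all-↭ (disjoint b) p) (pairwiseDisjoint-↭ p)
pairwiseDisjoint-↭ {bs = b ∷ c ∷ bs} {c ∷ b ∷ cs} (↭.swap b c p) = begin
  (disjoint b c ∧ all (disjoint b) bs) ∧ (all (disjoint c) bs ∧ pairwiseDisjoint bs)
    ≡⟨ cong₂ (λ x y → (disjoint b c ∧ x) ∧ y) (all-↭ (disjoint b) p)
             (cong₂ _∧_ (all-↭ (disjoint c) p) (pairwiseDisjoint-↭ p)) ⟩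
  (disjoint b c ∧ all (disjoint b) cs) ∧ (all (disjoint c) cs ∧ pairwiseDisjoint cs)
    ≡⟨ cong (λ x → (x ∧ all (disjoint b) cs) ∧ (all (disjoint c) cs ∧ pairwiseDisjoint cs))
            (disjoint-comm b c) ⟩
  (disjoint c b ∧ all (disjoint b) cs) ∧ (all (disjoint c) cs ∧ pairwiseDisjoint cs)
    ≡⟨ Bool-∧.interchange (disjoint c b) _ _ _ ⟩
  (disjoint c b ∧ all (disjoint c) cs) ∧ (all (disjoint b) cs ∧ pairwiseDisjoint cs) ∎
  where open ≡-Reasoning
pairwiseDisjoint-↭ (↭.trans p q) = trans (pairwiseDisjoint-↭ p) (pairwiseDisjoint-↭ q)

isPartition-↭ : ∀ {n} {bs cs : List (Subset n)} → bs ↭ cs → isPartition bs ≡ isPartition cs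
isPartition-↭ p = cong₂ _∧_ (all-↭ (not ∘ isEmpty) p)
                            (cong₂ _∧_ (pairwiseDisjoint-↭ p) (cong isFull (union-↭ p)))

map-swap-subsets : ∀ n j → map (swap j) (subsets n) ↭ subsets n
map-swap-subsets zero          zero    = ↭.refl
map-swap-subsets zero          (suc j) = ↭.refl
map-swap-subsets (suc zero)    zero    = ↭.refl
map-swap-subsets (suc (suc n)) zero    = begin
  map (swap 0) (subsets (suc (suc n)))
    ≡⟨ cong (map (swap 0)) quarters ⟩
  map (swap 0) ((q false false ++ q false true) ++ (q true false ++ q true true))
    ≡⟨ map-++ (swap 0) (q false false ++ q false true) _ ⟩
  map (swap 0) (q false false ++ q false true) ++ map (swap 0) (q true false ++ q true true)
    ≡⟨ cong₂ _++_ (trans (map-++ (swap 0) (q false false) _) (cong₂ _++_ (swap-q false false) (swap-q true false)))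
                  (trans (map-++ (swap 0) (q true false) _) (cong₂ _++_ (swap-q false true) (swap-q true true))) ⟩
  (q false false ++ q true false) ++ (q false true ++ q true true)
    ≡⟨ ++-assoc (q false false) _ _ ⟩
  q false false ++ (q true false ++ (q false true ++ q true true))
    ↭⟨ ↭.++⁺ˡ (q false false) (↭.shifts (q true false) (q false true)) ⟩
  q false false ++ (q false true ++ (q true false ++ q true true))
    ≡⟨ ++-assoc (q false false) _ _ ⟨
  (q false false ++ q false true) ++ (q true false ++ q true true)
    ≡⟨ quarters ⟨
  subsets (suc (suc n)) ∎
  where
  open ↭.PermutationReasoning
  q : Bool → Bool → List (Subset (suc (suc n)))
  q x y = map (λ b → x ∷ y ∷ b) (subsets n)
  quarters : subsets (suc (suc n)) ≡ (q false false ++ q false true) ++ (q true false ++ q true true)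
  quarters = cong₂ _++_ (halves false) (halves true)
    where
    halves : ∀ x → map (x ∷_) (subsets (suc n)) ≡ q x false ++ q x true
    halves x = trans (map-++ (x ∷_) (map (false ∷_) (subsets n)) _)
                     (cong₂ _++_ (sym (map-∘ (subsets n))) (sym (map-∘ (subsets n))))
  swap-q : ∀ x y → map (swap 0) (q y x) ≡ q x y
  swap-q x y = sym (map-∘ (subsets n))
map-swap-subsets (suc n)       (suc j) = begin
  map (swap (suc j)) (map (false ∷_) (subsets n) ++ map (true ∷_) (subsets n))
    ≡⟨ map-++ (swap (suc j)) (map (false ∷_) (subsets n)) _ ⟩
  map (swap (suc j)) (map (false ∷_) (subsets n)) ++ map (swap (suc j)) (map (true ∷_) (subsets n))
    ≡⟨ cong₂ _++_ (swap-cons false) (swap-cons true) ⟩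
  map (false ∷_) (map (swap j) (subsets n)) ++ map (true ∷_) (map (swap j) (subsets n))
    ↭⟨ ↭.++⁺ (↭.map⁺ (false ∷_) (map-swap-subsets n j)) (↭.map⁺ (true ∷_) (map-swap-subsets n j)) ⟩
  map (false ∷_) (subsets n) ++ map (true ∷_) (subsets n) ∎
  where
  open ↭.PermutationReasoning
  swap-cons : ∀ x → map (swap (suc j)) (map (x ∷_) (subsets n)) ≡ map (x ∷_) (map (swap j) (subsets n))
  swap-cons x = trans (sym (map-∘ (subsets n))) (map-∘ (subsets n))

-- Partitions with tagged elements

data Tag : Set where
  free single nonSingle : Tag

isSingle : Tag → Bool
isSingle single = true
isSingle _      = false

isNonSingle : Tag → Bool
isNonSingle nonSingle = true
isNonSingle _         = false

respects : ∀ {n} → Vec Tag n → Subset n → Bool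
respects ts b = if isSingleton b then disjoint b (Vec.map isNonSingle ts)
                                 else disjoint b (Vec.map isSingle ts)

isTaggedPartition : ∀ {n} → Vec Tag n → List (Subset n) → Bool
isTaggedPartition ts bs = isPartition bs ∧ all (respects ts) bs

taggedBell : ∀ {n} → Vec Tag n → ℕ
taggedBell {n} ts = sumBy (fromBool ∘ isTaggedPartition ts) (sublists (subsets n))

respects-swap : ∀ {n} j (ts : Vec Tag n) b → respects (swap j ts) (swap j b) ≡ respects ts b
respects-swap j ts b
  rewrite isSingleton-swap j b
        | sym (swap-map isNonSingle j ts) | disjoint-swap j b (Vec.map isNonSingle ts)
        | sym (swap-map isSingle j ts)    | disjoint-swap j b (Vec.map isSingle ts)
  = refl

isTaggedPartition-map-swap : ∀ {n} j (ts : Vec Tag n) bs →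
  isTaggedPartition ts (map (swap j) bs) ≡ isTaggedPartition (swap j ts) bs
isTaggedPartition-map-swap j ts bs = cong₂ _∧_ (isPartition-map-swap j bs)
  (trans (all-map (respects ts) (swap j) bs) (all-cong respects-swapped bs))
  where
  respects-swapped : ∀ b → respects ts (swap j b) ≡ respects (swap j ts) b
  respects-swapped b = trans (cong (λ us → respects us (swap j b)) (sym (swap-involutive j ts)))
                             (respects-swap j (swap j ts) b)

isTaggedPartition-↭ : ∀ {n} (ts : Vec Tag n) {bs cs} → bs ↭ cs →
                      isTaggedPartition ts bs ≡ isTaggedPartition ts cs
isTaggedPartition-↭ ts p = cong₂ _∧_ (isPartition-↭ p) (all-↭ (respects ts) p)

taggedBell-swap : ∀ {n} j (ts : Vec Tag n) → taggedBell (swap j ts) ≡ taggedBell ts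
taggedBell-swap {n} j ts = sym (begin
  sumBy F (sublists (subsets n))
    ≡⟨ sumBy-sublists-↭ F (cong fromBool ∘ isTaggedPartition-↭ ts) (map-swap-subsets n j) ⟨
  sumBy F (sublists (map (swap j) (subsets n)))
    ≡⟨ cong (sumBy F) (sublists-map (swap j) (subsets n)) ⟩
  sumBy F (map (map (swap j)) (sublists (subsets n)))
    ≡⟨ sumBy-map F (map (swap j)) (sublists (subsets n)) ⟩
  sumBy (F ∘ map (swap j)) (sublists (subsets n))
    ≡⟨ sumBy-cong (cong fromBool ∘ isTaggedPartition-map-swap j ts) (sublists (subsets n)) ⟩
  taggedBell (swap j ts) ∎)
  where
  open ≡-Reasoning
  F : List (Subset n) → ℕ
  F = fromBool ∘ isTaggedPartition ts

_⇝_ : ∀ {X : Set} {n} → Rel (Vec X n) 0ℓ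
u ⇝ v = ∃[ j ] swap j u ≡ v

_⇝*_ : ∀ {X : Set} {n} → Rel (Vec X n) 0ℓ
_⇝*_ = Star _⇝_

⇝*-∷ : ∀ {X : Set} {n} (x : X) {u v : Vec X n} → u ⇝* v → (x ∷ u) ⇝* (x ∷ v)
⇝*-∷ x ε                 = ε
⇝*-∷ x ((j , refl) ◅ u⇝*v) = (suc j , refl) ◅ ⇝*-∷ x u⇝*v

taggedBell-⇝* : ∀ {n} {ts us : Vec Tag n} → ts ⇝* us → taggedBell ts ≡ taggedBell us
taggedBell-⇝* ε                   = refl
taggedBell-⇝* {ts = ts} ((j , refl) ◅ ts⇝*us) = trans (sym (taggedBell-swap j ts)) (taggedBell-⇝* ts⇝*us)

-- Splitting off the block of the first element

joinHead : ∀ {n} → Subset n → List (Subset n) → List (Subset (suc n))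
joinHead c as = (inside ∷ c) ∷ map (outside ∷_) as

union-map-outside : ∀ {n} (as : List (Subset n)) → union (map (outside ∷_) as) ≡ outside ∷ union as
union-map-outside []       = refl
union-map-outside (a ∷ as) = cong ((outside ∷ a) ∪_) (union-map-outside as)

pairwiseDisjoint-map-outside : ∀ {n} (as : List (Subset n)) →
  pairwiseDisjoint (map (outside ∷_) as) ≡ pairwiseDisjoint as
pairwiseDisjoint-map-outside []       = refl
pairwiseDisjoint-map-outside (a ∷ as) =
  cong₂ _∧_ (all-map (disjoint (outside ∷ a)) (outside ∷_) as) (pairwiseDisjoint-map-outside as)

isPartition-map-outside : ∀ {n} (as : List (Subset n)) → isPartition (map (outside ∷_) as) ≡ false
isPartition-map-outside as
  rewrite union-map-outside as =
  trans (cong (all (not ∘ isEmpty) (map (outside ∷_) as) ∧_) (∧-zeroʳ _)) (∧-zeroʳ _)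

pairwiseDisjoint-two-blocks-with-0 : ∀ {n} (os : List (Subset (suc n))) c d cs →
  pairwiseDisjoint (os ++ map (inside ∷_) (c ∷ d ∷ cs)) ≡ false
pairwiseDisjoint-two-blocks-with-0 []       c d cs = refl
pairwiseDisjoint-two-blocks-with-0 {n} (o ∷ os) c d cs =
  trans (cong (all (disjoint o) rest ∧_) (pairwiseDisjoint-two-blocks-with-0 os c d cs))
        (∧-zeroʳ (all (disjoint o) rest))
  where
  rest : List (Subset (suc n))
  rest = os ++ map (inside ∷_) (c ∷ d ∷ cs)

isPartition-two-blocks-with-0 : ∀ {n} (os : List (Subset (suc n))) c d cs →
  isPartition (os ++ map (inside ∷_) (c ∷ d ∷ cs)) ≡ false
isPartition-two-blocks-with-0 os c d cs
  rewrite pairwiseDisjoint-two-blocks-with-0 os c d cs = ∧-zeroʳ _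

isTaggedPartition-joinHead : ∀ {n} t (ts : Vec Tag n) c as →
  isTaggedPartition (t ∷ ts) (joinHead c as) ≡
  isPartition (joinHead c as) ∧ (respects (t ∷ ts) (inside ∷ c) ∧ all (respects ts) as)
isTaggedPartition-joinHead t ts c as =
  cong (λ r → isPartition (joinHead c as) ∧ (respects (t ∷ ts) (inside ∷ c) ∧ r))
       (all-map (respects (t ∷ ts)) (outside ∷_) as)

taggedBell-∷ : ∀ {n} t (ts : Vec Tag n) →
  taggedBell (t ∷ ts) ≡
  sumBy (λ as → sumBy (λ c → fromBool (isTaggedPartition (t ∷ ts) (joinHead c as))) (subsets n))
        (sublists (subsets n))
taggedBell-∷ {n} t ts = begin
  sumBy F (sublists (map O S ++ map I S))
    ≡⟨ sumBy-sublists-++ F (map O S) (map I S) ⟩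
  sumBy (λ os → sumBy (F ∘ (os ++_)) (sublists (map I S))) (sublists (map O S))
    ≡⟨ cong₂ (λ oss iss → sumBy (λ os → sumBy (F ∘ (os ++_)) iss) oss)
             (sublists-map O S) (sublists-map I S) ⟩
  sumBy (λ os → sumBy (F ∘ (os ++_)) (map (map I) (sublists S))) (map (map O) (sublists S))
    ≡⟨ sumBy-map _ (map O) (sublists S) ⟩
  sumBy (λ as → sumBy (F ∘ (map O as ++_)) (map (map I) (sublists S))) (sublists S)
    ≡⟨ sumBy-cong (λ as → sumBy-map (F ∘ (map O as ++_)) (map I) (sublists S)) (sublists S) ⟩
  sumBy (λ as → sumBy (λ cs → F (map O as ++ map I cs)) (sublists S)) (sublists S)
    ≡⟨ sumBy-cong (λ as → sumBy-sublists-singletons-only _ (no-block-with-0 as) (two-blocks-with-0 as) S)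
                  (sublists S) ⟩
  sumBy (λ as → sumBy (λ c → F (map O as ++ [ I c ])) S) (sublists S)
    ≡⟨ sumBy-cong (λ as → sumBy-cong (λ c → cong fromBool (block-of-0-first as c)) S) (sublists S) ⟩
  sumBy (λ as → sumBy (λ c → F (joinHead c as)) S) (sublists S) ∎
  where
  open ≡-Reasoning
  S : List (Subset n)
  S = subsets n
  O I : Subset n → Subset (suc n)
  O = outside ∷_
  I = inside ∷_
  F : List (Subset (suc n)) → ℕ
  F = fromBool ∘ isTaggedPartition (t ∷ ts)
  no-block-with-0 : ∀ as → F (map O as ++ []) ≡ 0
  no-block-with-0 as rewrite ++-identityʳ (map O as) | isPartition-map-outside as = refl
  two-blocks-with-0 : ∀ as c d cs → F (map O as ++ map I (c ∷ d ∷ cs)) ≡ 0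
  two-blocks-with-0 as c d cs rewrite isPartition-two-blocks-with-0 (map O as) c d cs = refl
  block-of-0-first : ∀ as c → isTaggedPartition (t ∷ ts) (map O as ++ [ I c ]) ≡
                              isTaggedPartition (t ∷ ts) (joinHead c as)
  block-of-0-first as c = isTaggedPartition-↭ (t ∷ ts) (↭.++-comm (map O as) [ I c ])

taggedBell-free : ∀ {n} (ts : Vec Tag n) →
                  taggedBell (free ∷ ts) ≡ taggedBell (single ∷ ts) + taggedBell (nonSingle ∷ ts)
taggedBell-free {n} ts = begin
  taggedBell (free ∷ ts)
    ≡⟨ taggedBell-∷ free ts ⟩
  sumBy (λ as → sumBy (λ c → G free as c) (subsets n)) (sublists (subsets n))
    ≡⟨ sumBy-cong (λ as → trans (sumBy-cong (split as) (subsets n))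
                                (sumBy-+ (G single as) (G nonSingle as) (subsets n)))
                  (sublists (subsets n)) ⟩
  sumBy (λ as → sumBy (G single as) (subsets n) + sumBy (G nonSingle as) (subsets n)) (sublists (subsets n))
    ≡⟨ sumBy-+ _ _ (sublists (subsets n)) ⟩
  sumBy (λ as → sumBy (G single as) (subsets n)) (sublists (subsets n)) +
  sumBy (λ as → sumBy (G nonSingle as) (subsets n)) (sublists (subsets n))
    ≡⟨ cong₂ _+_ (taggedBell-∷ single ts) (taggedBell-∷ nonSingle ts) ⟨
  taggedBell (single ∷ ts) + taggedBell (nonSingle ∷ ts) ∎
  where
  open ≡-Reasoning
  G : Tag → List (Subset n) → Subset n → ℕ
  G t as c = fromBool (isTaggedPartition (t ∷ ts) (joinHead c as))
  split-if : ∀ p e x y r → fromBool (p ∧ ((if e then x else y) ∧ r)) ≡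
             fromBool (p ∧ ((if e then x else false) ∧ r)) + fromBool (p ∧ ((if e then false else y) ∧ r))
  split-if false e     x y r = refl
  split-if true  true  x y r = sym (ℕ.+-identityʳ _)
  split-if true  false x y r = refl
  -- The block of 0 is a singleton exactly when c is empty.
  split : ∀ as c → G free as c ≡ G single as c + G nonSingle as c
  split as c
    rewrite isTaggedPartition-joinHead free ts c as
          | isTaggedPartition-joinHead single ts c as
          | isTaggedPartition-joinHead nonSingle ts c as
    = split-if (isPartition (joinHead c as)) (isEmpty c) (disjoint c (Vec.map isNonSingle ts))
               (disjoint c (Vec.map isSingle ts)) (all (respects ts) as)

isEmpty-⊥ : ∀ n → isEmpty (⊥ {n}) ≡ true
isEmpty-⊥ zero    = refl
isEmpty-⊥ (suc n) = isEmpty-⊥ n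

disjoint-⊥ˡ : ∀ {n} (b : Subset n) → disjoint ⊥ b ≡ true
disjoint-⊥ˡ []      = refl
disjoint-⊥ˡ (x ∷ b) = disjoint-⊥ˡ b

disjoint-⊥ʳ : ∀ {n} (b : Subset n) → disjoint b ⊥ ≡ true
disjoint-⊥ʳ b = trans (disjoint-comm b ⊥) (disjoint-⊥ˡ b)

sumBy-subsets-⊥ : ∀ n (g : Subset n → ℕ) → (∀ c → isEmpty c ≡ false → g c ≡ 0) →
                  sumBy g (subsets n) ≡ g ⊥
sumBy-subsets-⊥ zero    g g≡0 = ℕ.+-identityʳ (g [])
sumBy-subsets-⊥ (suc n) g g≡0 = begin
  sumBy g (map (outside ∷_) (subsets n) ++ map (inside ∷_) (subsets n))
    ≡⟨ sumBy-++ g (map (outside ∷_) (subsets n)) _ ⟩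
  sumBy g (map (outside ∷_) (subsets n)) + sumBy g (map (inside ∷_) (subsets n))
    ≡⟨ cong₂ _+_ (sumBy-map g (outside ∷_) (subsets n)) (sumBy-map g (inside ∷_) (subsets n)) ⟩
  sumBy (g ∘ (outside ∷_)) (subsets n) + sumBy (g ∘ (inside ∷_)) (subsets n)
    ≡⟨ cong₂ _+_ (sumBy-subsets-⊥ n (g ∘ (outside ∷_)) (g≡0 ∘ (outside ∷_)))
                 (sumBy-zero (λ c → g≡0 (inside ∷ c) refl) (subsets n)) ⟩
  g ⊥ + 0
    ≡⟨ ℕ.+-identityʳ (g ⊥) ⟩
  g ⊥ ∎
  where open ≡-Reasoning

isPartition-joinHead-⊥ : ∀ {n} (as : List (Subset n)) → isPartition (joinHead ⊥ as) ≡ isPartition as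
isPartition-joinHead-⊥ as
  rewrite all-map (not ∘ isEmpty) (outside ∷_) as
        | all-map (disjoint (inside ∷ ⊥)) (outside ∷_) as | all-true disjoint-⊥ˡ as
        | pairwiseDisjoint-map-outside as
        | union-map-outside as | ∪-identityˡ (union as)
  = refl

taggedBell-single : ∀ {n} (ts : Vec Tag n) → taggedBell (single ∷ ts) ≡ taggedBell ts
taggedBell-single {n} ts =
  trans (taggedBell-∷ single ts)
        (sumBy-cong (λ as → trans (sumBy-subsets-⊥ n _ (nonempty-head as)) (cong fromBool (singleton-head as)))
                    (sublists (subsets n)))
  where
  nonempty-head : ∀ as c → isEmpty c ≡ false → fromBool (isTaggedPartition (single ∷ ts) (joinHead c as)) ≡ 0
  nonempty-head as c c≢∅ rewrite isTaggedPartition-joinHead single ts c as | c≢∅ = cong fromBool (∧-zeroʳ _)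
  singleton-head : ∀ as → isTaggedPartition (single ∷ ts) (joinHead ⊥ as) ≡ isTaggedPartition ts as
  singleton-head as
    rewrite isTaggedPartition-joinHead single ts ⊥ as
          | isPartition-joinHead-⊥ as | isEmpty-⊥ n | disjoint-⊥ˡ (Vec.map isNonSingle ts)
    = refl

taggedBell-replicate-free : ∀ n → taggedBell (replicate n free) ≡ Bell n
taggedBell-replicate-free n = sym (trans (length-filter isPartition (sublists (subsets n)))
                                    (sumBy-cong (cong fromBool ∘ no-constraint) (sublists (subsets n))))
  where
  respects-free : ∀ b → respects (replicate n free) b ≡ true
  respects-free b rewrite map-replicate isNonSingle free n | map-replicate isSingle free n | disjoint-⊥ʳ b
    with isSingleton b
  ... | true  = refl
  ... | false = refl
  no-constraint : ∀ bs → isPartition bs ≡ isTaggedPartition (replicate n free) bs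
  no-constraint bs rewrite all-true respects-free bs = sym (∧-identityʳ (isPartition bs))

-- The numbers A as tagged Bell numbers

layout : ℕ → (n : ℕ) → Vec Tag n
layout a       zero    = []
layout zero    (suc n) = single ∷ replicate n nonSingle
layout (suc a) (suc n) = free ∷ layout a n

layout-diagonal : ∀ a → layout a a ≡ replicate a free
layout-diagonal zero    = refl
layout-diagonal (suc a) = cong (free ∷_) (layout-diagonal a)

nonSingle-∷-layout : ∀ {a n} → a < n → (nonSingle ∷ layout a n) ⇝* layout a (suc n)
nonSingle-∷-layout {zero}  {suc n} _         = (0 , refl) ◅ ε
nonSingle-∷-layout {suc a} {suc n} (s≤s a<n) = (0 , refl) ◅ ⇝*-∷ free (nonSingle-∷-layout a<n)

layout-single-to-front : ∀ a → layout a (suc a) ⇝* (single ∷ layout a a)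
layout-single-to-front zero    = ε
layout-single-to-front (suc a) = ⇝*-∷ free (layout-single-to-front a) ◅◅ ((0 , refl) ◅ ε)

member : ∀ {n} → ℕ → Subset n → Bool
member i       []      = false
member zero    (x ∷ b) = x
member (suc i) (x ∷ b) = member i b

member-⊥ : ∀ n i → member i (⊥ {n}) ≡ false
member-⊥ zero    i       = refl
member-⊥ (suc n) zero    = refl
member-⊥ (suc n) (suc i) = member-⊥ n i

member-∪ : ∀ {n} i (b c : Subset n) → member i (b ∪ c) ≡ member i b ∨ member i c
member-∪ i       []      []      = refl
member-∪ zero    (x ∷ b) (y ∷ c) = refl
member-∪ (suc i) (x ∷ b) (y ∷ c) = member-∪ i b c

member-full : ∀ {n} {i} (u : Subset n) → isFull u ≡ true → i < n → member i u ≡ true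
member-full {i = zero}  (true ∷ u) _      _         = refl
member-full {i = suc i} (true ∷ u) u-full (s≤s i<n) = member-full u u-full i<n

member-disjoint : ∀ {n} i (b c : Subset n) → disjoint b c ≡ true → member i b ≡ true → member i c ≡ false
member-disjoint zero    (true ∷ b) (false ∷ c) _       _ = refl
member-disjoint (suc i) (x ∷ b)    (y ∷ c)     b∩c≡∅ i∈b =
  member-disjoint i b c (∧-conicalʳ _ _ b∩c≡∅) i∈b

member-replicate : ∀ {n i} (x : Bool) → i < n → member i (replicate n x) ≡ x
member-replicate {suc n} {zero}  x _         = refl
member-replicate {suc n} {suc i} x (s≤s i<n) = member-replicate x i<n

isEmpty⇒≡⊥ : ∀ {n} (b : Subset n) → isEmpty b ≡ true → b ≡ ⊥
isEmpty⇒≡⊥ []          _   = refl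
isEmpty⇒≡⊥ (false ∷ b) b≡∅ = cong (outside ∷_) (isEmpty⇒≡⊥ b b≡∅)

isSingleton-⁅⁆ : ∀ {n} (p : Fin n) → isSingleton ⁅ p ⁆ ≡ true
isSingleton-⁅⁆ {suc n} zero = isEmpty-⊥ n
isSingleton-⁅⁆ (suc p)      = isSingleton-⁅⁆ p

member-⁅⁆ : ∀ {n} i (p : Fin n) → member i ⁅ p ⁆ ≡ (toℕ p ℕ.≡ᵇ i)
member-⁅⁆         zero    zero    = refl
member-⁅⁆ {suc n} (suc i) zero    = member-⊥ n i
member-⁅⁆         zero    (suc p) = refl
member-⁅⁆         (suc i) (suc p) = member-⁅⁆ i p

disjoint-⁅⁆ : ∀ {n} (p : Fin n) M → disjoint ⁅ p ⁆ M ≡ not (member (toℕ p) M)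
disjoint-⁅⁆ zero    (x ∷ M) = trans (cong (not x ∧_) (disjoint-⊥ˡ M)) (∧-identityʳ (not x))
disjoint-⁅⁆ (suc p) (x ∷ M) = disjoint-⁅⁆ p M

singletonAt≡just : ∀ {n} (b : Subset n) {i} → singletonAt b ≡ just i → ∃[ p ] (toℕ p ≡ i × b ≡ ⁅ p ⁆)
singletonAt≡just (inside ∷ b) eq with isEmpty b in b≡∅
singletonAt≡just (inside ∷ b) refl | true = zero , refl , cong (inside ∷_) (isEmpty⇒≡⊥ b b≡∅)
singletonAt≡just (outside ∷ b) eq with singletonAt b in at-i
singletonAt≡just (outside ∷ b) refl | just i with singletonAt≡just b at-i
... | p , refl , refl = suc p , refl , refl

singletonAt≡nothing : ∀ {n} (b : Subset n) → singletonAt b ≡ nothing → isSingleton b ≡ false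
singletonAt≡nothing [] _ = refl
singletonAt≡nothing (inside ∷ b) eq with isEmpty b
singletonAt≡nothing (inside ∷ b) ()   | true
singletonAt≡nothing (inside ∷ b) _    | false = refl
singletonAt≡nothing (outside ∷ b) eq with singletonAt b in nowhere
singletonAt≡nothing (outside ∷ b) ()  | just i
singletonAt≡nothing (outside ∷ b) _   | nothing = singletonAt≡nothing b nowhere

isSingletonAt-member : ∀ {n} a (b : Subset n) → isSingletonAt a b ≡ isSingleton b ∧ member a b
isSingletonAt-member a b with singletonAt b in at-i
... | just i with singletonAt≡just b at-i
...   | p , refl , refl rewrite isSingleton-⁅⁆ p | member-⁅⁆ a p = refl
isSingletonAt-member a b | nothing rewrite singletonAt≡nothing b at-i = refl

≤ᵇ-suc : ∀ m n → (suc m ℕ.≤ᵇ suc n) ≡ (m ℕ.≤ᵇ n)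
≤ᵇ-suc zero    n = refl
≤ᵇ-suc (suc m) n = refl

member-nonSingle-layout : ∀ {n} a {i} → i < n → member i (Vec.map isNonSingle (layout a n)) ≡ not (i ℕ.≤ᵇ a)
member-nonSingle-layout {suc n} zero    {zero}  _ = refl
member-nonSingle-layout {suc n} zero    {suc i} (s≤s i<n)
  rewrite map-replicate isNonSingle nonSingle n = member-replicate true i<n
member-nonSingle-layout {suc n} (suc a) {zero}  _ = refl
member-nonSingle-layout {suc n} (suc a) {suc i} (s≤s i<n) =
  trans (member-nonSingle-layout a i<n) (cong not (sym (≤ᵇ-suc i a)))

disjoint-single-layout : ∀ {n a} → a < n → ∀ b → disjoint b (Vec.map isSingle (layout a n)) ≡ not (member a b)
disjoint-single-layout {suc n} {zero}  _ (x ∷ b)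
  rewrite map-replicate isSingle nonSingle n | disjoint-⊥ʳ b | ∧-identityʳ x = ∧-identityʳ (not x)
disjoint-single-layout {suc n} {suc a} (s≤s a<n) (x ∷ b)
  rewrite ∧-zeroʳ x = disjoint-single-layout a<n b

respects-layout : ∀ {n a} → a < n → ∀ b →
  respects (layout a n) b ≡ singletonAtMost a b ∧ (isSingleton b ∨ not (member a b))
respects-layout {n} {a} a<n b with singletonAt b in at-i
... | just i with singletonAt≡just b at-i
...   | p , refl , refl
  rewrite isSingleton-⁅⁆ p | disjoint-⁅⁆ p (Vec.map isNonSingle (layout a n))
        | member-nonSingle-layout a (toℕ<n p)
  = trans (not-involutive _) (sym (∧-identityʳ _))
respects-layout a<n b | nothing rewrite singletonAt≡nothing b at-i = disjoint-single-layout a<n b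

absent-elsewhere : ∀ {n} a (b : Subset n) bs → all (disjoint b) bs ≡ true → member a b ≡ true →
  any (λ c → isSingleton c ∧ member a c) bs ≡ false × all (λ c → isSingleton c ∨ not (member a c)) bs ≡ true
absent-elsewhere a b []       _       _   = refl , refl
absent-elsewhere a b (c ∷ bs) b∩bs≡∅ a∈b
  rewrite member-disjoint a b c (∧-conicalˡ _ _ b∩bs≡∅) a∈b
        | ∧-zeroʳ (isSingleton c) | ∨-zeroʳ (isSingleton c)
  = absent-elsewhere a b bs (∧-conicalʳ _ _ b∩bs≡∅) a∈b

singleton-block-of : ∀ {n} a (bs : List (Subset n)) → pairwiseDisjoint bs ≡ true → member a (union bs) ≡ true →
  any (λ b → isSingleton b ∧ member a b) bs ≡ all (λ b → isSingleton b ∨ not (member a b)) bs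
singleton-block-of {n} a [] _ a∈⋃ rewrite member-⊥ n a with a∈⋃
... | ()
singleton-block-of a (b ∷ bs) disj a∈⋃ rewrite member-∪ a b (union bs) with member a b in a∈b
... | true
  rewrite (absent-elsewhere a b bs (∧-conicalˡ _ _ disj) a∈b) .proj₁
        | (absent-elsewhere a b bs (∧-conicalˡ _ _ disj) a∈b) .proj₂
        | ∧-identityʳ (isSingleton b) | ∨-identityʳ (isSingleton b)
  = sym (∧-identityʳ (isSingleton b))
... | false
  rewrite ∧-zeroʳ (isSingleton b) | ∨-zeroʳ (isSingleton b)
  = singleton-block-of a bs (∧-conicalʳ _ _ disj) a∈⋃

largestSingletonIs-layout : ∀ {n a} → a < n → (bs : List (Subset n)) → isPartition bs ≡ true →
  largestSingletonIs a bs ≡ all (respects (layout a n)) bs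
largestSingletonIs-layout {n} {a} a<n bs partition = begin
  any (isSingletonAt a) bs ∧ all (singletonAtMost a) bs
    ≡⟨ cong (_∧ all (singletonAtMost a) bs) (any-cong (isSingletonAt-member a) bs) ⟩
  any (λ b → isSingleton b ∧ member a b) bs ∧ all (singletonAtMost a) bs
    ≡⟨ cong (_∧ all (singletonAtMost a) bs) (singleton-block-of a bs disjoint-blocks a-covered) ⟩
  all (λ b → isSingleton b ∨ not (member a b)) bs ∧ all (singletonAtMost a) bs
    ≡⟨ ∧-comm (all (λ b → isSingleton b ∨ not (member a b)) bs) _ ⟩
  all (singletonAtMost a) bs ∧ all (λ b → isSingleton b ∨ not (member a b)) bs
    ≡⟨ all-∧ (singletonAtMost a) (λ b → isSingleton b ∨ not (member a b)) bs ⟨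
  all (λ b → singletonAtMost a b ∧ (isSingleton b ∨ not (member a b))) bs
    ≡⟨ all-cong (respects-layout a<n) bs ⟨
  all (respects (layout a n)) bs ∎
  where
  open ≡-Reasoning
  disjoint-and-covering : pairwiseDisjoint bs ∧ isFull (union bs) ≡ true
  disjoint-and-covering = ∧-conicalʳ (all (not ∘ isEmpty) bs) _ partition
  disjoint-blocks : pairwiseDisjoint bs ≡ true
  disjoint-blocks = ∧-conicalˡ _ (isFull (union bs)) disjoint-and-covering
  a-covered : member a (union bs) ≡ true
  a-covered = member-full (union bs) (∧-conicalʳ (pairwiseDisjoint bs) _ disjoint-and-covering) a<n

A-layout : ∀ {N a} → a ≤ N → A N a ≡ taggedBell (layout a (suc N))
A-layout {N} {a} a≤N =
  trans (length-filter-filter isPartition (largestSingletonIs a) (sublists (subsets (suc N))))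
        (sumBy-cong (cong fromBool ∘ as-tags) (sublists (subsets (suc N))))
  where
  as-tags : ∀ bs → isPartition bs ∧ largestSingletonIs a bs ≡ isTaggedPartition (layout a (suc N)) bs
  as-tags bs with isPartition bs in partition
  ... | true  = largestSingletonIs-layout (s≤s a≤N) bs partition
  ... | false = refl

A-diagonal : ∀ a → A a a ≡ Bell a
A-diagonal a = begin
  A a a                              ≡⟨ A-layout {a} {a} ℕ.≤-refl ⟩
  taggedBell (layout a (suc a))      ≡⟨ taggedBell-⇝* (layout-single-to-front a) ⟩
  taggedBell (single ∷ layout a a)   ≡⟨ taggedBell-single (layout a a) ⟩
  taggedBell (layout a a)            ≡⟨ cong taggedBell (layout-diagonal a) ⟩
  taggedBell (replicate a free)      ≡⟨ taggedBell-replicate-free a ⟩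
  Bell a                             ∎
  where open ≡-Reasoning

A-pascal : ∀ a b → A (b + suc a) (suc a) ≡ A (b + a) a + A (suc b + a) a
A-pascal a b = begin
  A (b + suc a) (suc a)
    ≡⟨ cong (λ N → A N (suc a)) (ℕ.+-suc b a) ⟩
  A (suc N) (suc a)
    ≡⟨ A-layout {suc N} {suc a} (s≤s (ℕ.m≤n+m a b)) ⟩
  taggedBell (free ∷ layout a (suc N))
    ≡⟨ taggedBell-free (layout a (suc N)) ⟩
  taggedBell (single ∷ layout a (suc N)) + taggedBell (nonSingle ∷ layout a (suc N))
    ≡⟨ cong₂ _+_ (taggedBell-single (layout a (suc N)))
                 (taggedBell-⇝* (nonSingle-∷-layout (s≤s (ℕ.m≤n+m a b)))) ⟩
  taggedBell (layout a (suc N)) + taggedBell (layout a (suc (suc N)))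
    ≡⟨ cong₂ _+_ (A-layout (ℕ.m≤n+m a b)) (A-layout (ℕ.m≤n⇒m≤1+n (ℕ.m≤n+m a b))) ⟨
  A N a + A (suc N) a ∎
  where
  open ≡-Reasoning
  N : ℕ
  N = b + a

pos-sumTo : ∀ n f → + sumTo n f ≡ sumToℤ n (λ j → + f j)
pos-sumTo n f = pos-foldr (applyUpTo id (suc n))
  where
  pos-foldr : ∀ js → + foldr (λ j acc → f j + acc) 0 js ≡ foldr (λ j acc → + f j ℤ.+ acc) (+ 0) js
  pos-foldr []       = refl
  pos-foldr (j ∷ js) = trans (ℤ.pos-+ (f j) _) (cong (λ s → + f j ℤ.+ s) (pos-foldr js))

A-array : ℕ → ℕ → ℤ
A-array a b = + A (b + a) a

A-pascalArray : IsPascalArray A-array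
A-pascalArray a b = trans (cong +_ (A-pascal a b)) (ℤ.pos-+ (A (b + a) a) _)

A-alternating : ∀ n m →
  + A (n + m) m ≡ sumToℤ n (λ j → (-1ℤ ^ (n ∸ j)) ℤ.* (+ (n C j) ℤ.* + Bell (m + j)))
A-alternating n m = begin
  + A (n + m) m
    ≡⟨ pascalArray-alternating {A-array} A-pascalArray n m ⟩
  binomialSum n (λ j → (-1ℤ ^ (n ∸ j)) ℤ.* + A (m + j) (m + j))
    ≡⟨ binomialSum-cong n (λ j _ → cong (λ x → (-1ℤ ^ (n ∸ j)) ℤ.* + x) (A-diagonal (m + j))) ⟩
  binomialSum n (λ j → (-1ℤ ^ (n ∸ j)) ℤ.* + Bell (m + j))
    ≡⟨ sumToℤ≡binomialSum n (λ j → ℤ-*.x∙yz≈y∙xz (-1ℤ ^ (n ∸ j)) (+ (n C j)) (+ Bell (m + j))) ⟨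
  sumToℤ n (λ j → (-1ℤ ^ (n ∸ j)) ℤ.* (+ (n C j) ℤ.* + Bell (m + j))) ∎
  where open ≡-Reasoning

A-binomial : ∀ n m k → A (n + m + k) (m + k) ≡ sumTo m (λ j → (m C j) * A (n + k + j) k)
A-binomial n m k = ℤ.+-injective (begin
  + A (n + m + k) (m + k)
    ≡⟨ cong (λ N → + A N (m + k)) (ℕ.+-assoc n m k) ⟩
  A-array (m + k) n
    ≡⟨ pascalArray-binomial {A-array} A-pascalArray m k n ⟩
  binomialSum m (λ j → + A (n + j + k) k)
    ≡⟨ binomialSum-cong m (λ j _ → cong (λ N → + A N k) (ℕ-+.xy∙z≈xz∙y n j k)) ⟩
  binomialSum m (λ j → + A (n + k + j) k)
    ≡⟨ sumToℤ≡binomialSum m (λ j → ℤ.pos-* (m C j) (A (n + k + j) k)) ⟨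
  sumToℤ m (λ j → + ((m C j) * A (n + k + j) k))
    ≡⟨ pos-sumTo m (λ j → (m C j) * A (n + k + j) k) ⟨
  + sumTo m (λ j → (m C j) * A (n + k + j) k) ∎)
  where open ≡-Reasoning

theorem2p4 : (n m k : ℕ) →
    (+ A (n + m) m ≡ sumToℤ n (λ j → ((- (+ 1)) ^ (n ∸ j)) ℤ.* ((+ (n C j)) ℤ.* (+ Bell (m + j)))))
    × (A (n + m + k) (m + k) ≡ sumTo m (λ j → (m C j) * A (n + k + j) k))
theorem2p4 n m k = A-alternating n m , A-binomial n m k
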